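{- Let $\mathcal{A}_1,\dots,\mathcal{A}_k\subset 2^{[n]}$ be families of sets. For any $i\in[n]$, $$\mathrm{VC}\big(\mathcal{C}_i(\mathcal{A}_1)\triangle\cdots\triangle\mathcal{C}_i(\mathcal{A}_k)\big)\le \mathrm{VC}(\mathcal{A}_1\triangle\cdots\triangle\mathcal{A}_k).$$
   Context: $[n]=\{1,\dots,n\}$. For a family $\mathcal{F}\subset 2^{[n]}$, a set $Y\subset[n]$ is shattered by $\mathcal{F}$ if $\{S\cap Y: S\in\mathcal{F}\}=2^Y$; $\mathrm{VC}(\mathcal{F})$ is the largest cardinality of a set shattered by $\mathcal{F}$. For families $\mathcal{B}_1,\dots,\mathcal{B}_k$, $\mathcal{B}_1\triangle\cdots\triangle\mathcal{B}_k=\{S_1\triangle\cdots\triangle S_k: S_j\in\mathcal{B}_j\}$, where $\triangle$ is symmetric difference. For $i\in[n]$ and a family $\mathcal{A}\subset 2^{[n]}$, the $i$-compression is $\mathcal{C}_i(\mathcal{A})=\{\mathcal{C}_i(S): S\in\mathcal{A}\}$, where for $S\in\mathcal{A}$, $\mathcal{C}_i(S)=S$ if $S\setminus\{i\}\in\mathcal{A}$, and $\mathcal{C}_i(S)=S\setminus\{i\}$ otherwise (compression of each $\mathcal{A}_j$ is taken with respect to $\mathcal{A}_j$ itself). -}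

module Defs where

open import Data.Nat using (ℕ; zero; suc; _⊔_; _≤_)
open import Data.Bool using (Bool; true; false; _xor_; if_then_else_)
open import Data.Fin using (Fin)
open import Data.Fin.Subset using (Subset; _∩_; _⊆_; ∣_∣; ⊥; inside; outside)
open import Data.Fin.Subset.Properties using (_⊆?_)
open import Data.Vec using (Vec; []; _∷_; zipWith; _[_]≔_; foldr)
open import Data.Vec.Properties using (≡-dec)
open import Data.Bool.Properties renaming (_≟_ to _≟ᵇ_)
open import Data.List using (List; []; _∷_; map; _++_; concatMap)
import Data.List as L
import Data.List.Membership.DecPropositional as Mem
open import Data.List.Relation.Unary.All using (all?)
open import Data.List.Relation.Unary.Any using (any?)
open import Relation.Nullary using (¬_; Dec; yes; no)
open import Relation.Nullary.Decidable using (⌊_⌋; _→-dec_)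
open import Relation.Binary.PropositionalEquality using (_≡_)

-- Subsets of [n] are `Subset n` (characteristic vectors over Fin n).
-- A family of subsets of [n] is a finite list of subsets (multiplicities irrelevant).
Family : ℕ → Set
Family n = List (Subset n)

_≟ₛ_ : ∀ {n} (S T : Subset n) → Dec (S ≡ T)
_≟ₛ_ = ≡-dec _≟ᵇ_

_△_ : ∀ {n} → Subset n → Subset n → Subset n
S △ T = zipWith _xor_ S T

_△ᶠ_ : ∀ {n} → Family n → Family n → Family n
B △ᶠ C = concatMap (λ S → map (S △_) C) B

-- B₁ △ ⋯ △ Bₖ  (for k = 0 this is {∅}, the empty symmetric difference)
△ᶠ-all : ∀ {n k} → Vec (Family n) k → Family n
△ᶠ-all []       = ⊥ ∷ []
△ᶠ-all (B ∷ []) = B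
△ᶠ-all (B ∷ Bs@(_ ∷ _)) = B △ᶠ △ᶠ-all Bs

allSubsets : (n : ℕ) → List (Subset n)
allSubsets zero    = [] ∷ []
allSubsets (suc n) = map (outside ∷_) (allSubsets n) ++ map (inside ∷_) (allSubsets n)

shattered? : ∀ {n} (Y : Subset n) (F : Family n) → Dec _
shattered? {n} Y F =
  all? (λ T → T ⊆? Y →-dec any? (λ S → (S ∩ Y) ≟ₛ T) F) (allSubsets n)

-- VC(F): the largest cardinality of a set shattered by F
-- (0 if no set is shattered, i.e. F = ∅).
VC : ∀ {n} → Family n → ℕ
VC {n} F = L.foldr (λ Y m → (if ⌊ shattered? Y F ⌋ then ∣ Y ∣ else 0) ⊔ m) 0 (allSubsets n)

_∖_ : ∀ {n} → Subset n → Fin n → Subset n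
S ∖ i = S [ i ]≔ outside

compressSet : ∀ {n} → Fin n → Family n → Subset n → Subset n
compressSet {n} i A S = if ⌊ Mem._∈?_ (_≟ₛ_ {n}) (S ∖ i) A ⌋ then S else (S ∖ i)

compress : ∀ {n} → Fin n → Family n → Family n
compress i A = map (compressSet i A) A

module Submission where

-- Fix a coordinate i.  Say that a family B′ is i-dominated by a family B if
--   (a) every x ∈ B′ has an i-variant (x with coordinate i set to some bit)
--       in B, and
--   (b) every x ∈ B′ with i ∈ x has both of its i-variants in B.
-- The proof has three independent parts.
--   1. 𝒞ᵢ(A) is i-dominated by A (an element kept in 𝒞ᵢ(A) while containing
--      i is an S with S ∖ {i} ∈ A).
--   2. i-domination is preserved by △ of families, since setting coordinate i
--      commutes with △ up to xor-ing the bits; hence by induction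
--      𝒞ᵢ(A₁) △ ⋯ △ 𝒞ᵢ(Aₖ) is i-dominated by A₁ △ ⋯ △ Aₖ.
--   3. If B′ is i-dominated by B, every set shattered by B′ is shattered by B:
--      for i ∉ Y any variant restricts to the same trace on Y, and for i ∈ Y
--      a witness for T ∪ {i} contains i, so both of its variants lie in B.
-- Finally VC is monotone with respect to inclusion of the shattered sets.

open import Defs
open import Data.Nat using (ℕ; _≤_; _⊔_; z≤n)
open import Data.Fin using (Fin; zero; suc) renaming (_≟_ to _≟ᶠ_)
open import Data.Vec using (Vec; []; _∷_; lookup; zipWith; _[_]≔_)
import Data.Vec as V
open import Data.Nat.Properties using (≤-refl; ⊔-mono-≤)
open import Data.Bool using (Bool; true; false; _xor_; _∧_; if_then_else_)
open import Data.Bool.Properties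
  using (xor-assoc; xor-same; xor-identityʳ; ∧-identityʳ; ∧-zeroʳ)
open import Data.Fin.Subset using (Subset; _∩_; _⊆_; ⊥; inside; outside; ∣_∣)
open import Data.Vec.Properties
  using (lookup-zipWith; lookup∘update; lookup∘update′; []≔-lookup; []≔-idempotent;
         lookup-replicate; lookup⇒[]=; []=⇒lookup)
open import Data.List using (List; []; _∷_; map)
import Data.List as L
open import Data.List.Membership.Propositional using (_∈_; find; lose)
open import Data.List.Membership.Propositional.Properties
  using (∈-map⁺; ∈-map⁻; ∈-concatMap⁺; ∈-concatMap⁻; ∈-++⁺ˡ; ∈-++⁺ʳ)
import Data.List.Membership.DecPropositional as Mem
open import Data.List.Relation.Unary.All as All using (All)
open import Data.List.Relation.Unary.Any using (Any; here)
open import Data.Product using (∃-syntax; _×_; _,_)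
open import Data.Sum using (_⊎_; inj₁; inj₂)
open import Relation.Nullary using (yes; no; contradiction)
open import Relation.Nullary.Decidable using (⌊_⌋)
open import Relation.Binary.PropositionalEquality
  using (_≡_; refl; sym; trans; cong; cong₂; subst; module ≡-Reasoning)

private variable n : ℕ

xor-cancelʳ : ∀ b c → (b xor c) xor c ≡ b
xor-cancelʳ b c = trans (xor-assoc b c c) (trans (cong (b xor_) (xor-same c)) (xor-identityʳ b))

xor-cancelˡ : ∀ c b → c xor (c xor b) ≡ b
xor-cancelˡ c b = trans (sym (xor-assoc c c b)) (cong (_xor b) (xor-same c))

xor≡true : ∀ a b → a xor b ≡ true → a ≡ true ⊎ b ≡ true
xor≡true true  _ _ = inj₁ refl
xor≡true false _ e = inj₂ e

zipWith-[]≔ : ∀ {A B C : Set} (f : A → B → C) (xs : Vec A n) (ys : Vec B n) i a b →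
              zipWith f (xs [ i ]≔ a) (ys [ i ]≔ b) ≡ zipWith f xs ys [ i ]≔ f a b
zipWith-[]≔ f (x ∷ xs) (y ∷ ys) zero    a b = refl
zipWith-[]≔ f (x ∷ xs) (y ∷ ys) (suc i) a b = cong (f x y ∷_) (zipWith-[]≔ f xs ys i a b)

△-[]≔ : (x y : Subset n) (i : Fin n) (b c : Bool) →
        (x [ i ]≔ b) △ (y [ i ]≔ c) ≡ (x △ y) [ i ]≔ (b xor c)
△-[]≔ = zipWith-[]≔ _xor_

∩-[]≔ : (x Y : Subset n) (i : Fin n) (b : Bool) →
        (x [ i ]≔ b) ∩ Y ≡ (x ∩ Y) [ i ]≔ (b ∧ lookup Y i)
∩-[]≔ x Y i b = begin
  (x [ i ]≔ b) ∩ Y                       ≡⟨ cong ((x [ i ]≔ b) ∩_) (sym ([]≔-lookup Y i)) ⟩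
  (x [ i ]≔ b) ∩ (Y [ i ]≔ lookup Y i)   ≡⟨ zipWith-[]≔ _∧_ x Y i b (lookup Y i) ⟩
  (x ∩ Y) [ i ]≔ (b ∧ lookup Y i)        ∎
  where open ≡-Reasoning

∩-[]≔-outside : (x Y : Subset n) (i : Fin n) (b : Bool) → lookup Y i ≡ false →
                (x [ i ]≔ b) ∩ Y ≡ x ∩ Y
∩-[]≔-outside x Y i b i∉Y = begin
  (x [ i ]≔ b) ∩ Y                       ≡⟨ ∩-[]≔ x Y i b ⟩
  (x ∩ Y) [ i ]≔ (b ∧ lookup Y i)        ≡⟨ cong (λ c → (x ∩ Y) [ i ]≔ (b ∧ c)) i∉Y ⟩
  (x ∩ Y) [ i ]≔ (b ∧ false)             ≡⟨ cong ((x ∩ Y) [ i ]≔_) (trans (∧-zeroʳ b) (sym (∧-zeroʳ (lookup x i)))) ⟩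
  (x ∩ Y) [ i ]≔ (lookup x i ∧ false)    ≡⟨ cong (λ c → (x ∩ Y) [ i ]≔ (lookup x i ∧ c)) (sym i∉Y) ⟩
  (x ∩ Y) [ i ]≔ (lookup x i ∧ lookup Y i) ≡⟨ sym (∩-[]≔ x Y i (lookup x i)) ⟩
  (x [ i ]≔ lookup x i) ∩ Y              ≡⟨ cong (_∩ Y) ([]≔-lookup x i) ⟩
  x ∩ Y                                  ∎
  where open ≡-Reasoning

[]≔-inside-⊆ : (i : Fin n) (T Y : Subset n) → T ⊆ Y → lookup Y i ≡ true →
               (T [ i ]≔ inside) ⊆ Y
[]≔-inside-⊆ i T Y T⊆Y i∈Y {j} j∈T′ with j ≟ᶠ i
... | yes refl = lookup⇒[]= i Y i∈Y
... | no  j≢i  = T⊆Y (lookup⇒[]= j T (trans (sym (lookup∘update′ j≢i T inside)) ([]=⇒lookup j∈T′)))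

△ᶠ⁺ : ∀ {S T : Subset n} (B C : Family n) → S ∈ B → T ∈ C → S △ T ∈ B △ᶠ C
△ᶠ⁺ {S = S} B C S∈B T∈C =
  ∈-concatMap⁺ (λ S → map (S △_) C) {xs = B} (lose S∈B (∈-map⁺ (S △_) T∈C))

△ᶠ⁻ : ∀ {x : Subset n} (B C : Family n) → x ∈ B △ᶠ C →
      ∃[ S ] ∃[ T ] S ∈ B × T ∈ C × x ≡ S △ T
△ᶠ⁻ B C x∈ with find (∈-concatMap⁻ (λ S → map (S △_) C) {xs = B} x∈)
... | S , S∈B , x∈S△C with ∈-map⁻ (S △_) x∈S△C
...   | T , T∈C , x≡S△T = S , T , S∈B , T∈C , x≡S△T

record Dominated (i : Fin n) (B′ B : Family n) : Set where
  field
    some-variant : ∀ {x} → x ∈ B′ → ∃[ b ] x [ i ]≔ b ∈ B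
    all-variants : ∀ {x} → x ∈ B′ → lookup x i ≡ true → ∀ b → x [ i ]≔ b ∈ B
open Dominated

compress-dominated : (i : Fin n) (A : Family n) → Dominated i (compress i A) A
compress-dominated {n} i A = record { some-variant = some ; all-variants = all }
  where
  some : ∀ {x} → x ∈ compress i A → ∃[ b ] x [ i ]≔ b ∈ A
  some x∈ with ∈-map⁻ (compressSet i A) x∈
  ... | S , S∈A , refl with Mem._∈?_ (_≟ₛ_ {n}) (S ∖ i) A
  ...   | yes _ = lookup S i , subst (_∈ A) (sym ([]≔-lookup S i)) S∈A
  ...   | no  _ = lookup S i ,
          subst (_∈ A) (sym (trans ([]≔-idempotent S i) ([]≔-lookup S i))) S∈A

  -- only an uncompressed S (one with S ∖ {i} ∈ A) can still contain i
  all : ∀ {x} → x ∈ compress i A → lookup x i ≡ true → ∀ b → x [ i ]≔ b ∈ A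
  all x∈ i∈x with ∈-map⁻ (compressSet i A) x∈
  ... | S , S∈A , refl with Mem._∈?_ (_≟ₛ_ {n}) (S ∖ i) A
  ...   | yes S∖i∈A = λ where
          true  → subst (_∈ A) (sym (trans (cong (S [ i ]≔_) (sym i∈x)) ([]≔-lookup S i))) S∈A
          false → S∖i∈A
  ...   | no  _ with trans (sym (lookup∘update i S false)) i∈x
  ...     | ()

△ᶠ-dominated : (i : Fin n) {A′ A R′ R : Family n} →
               Dominated i A′ A → Dominated i R′ R → Dominated i (A′ △ᶠ R′) (A △ᶠ R)
△ᶠ-dominated i {A′} {A} {R′} {R} dA dR = record { some-variant = some ; all-variants = all }
  where
  some : ∀ {x} → x ∈ A′ △ᶠ R′ → ∃[ b ] x [ i ]≔ b ∈ A △ᶠ R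
  some x∈ with △ᶠ⁻ A′ R′ x∈
  ... | S , T , S∈ , T∈ , refl with some-variant dA S∈ | some-variant dR T∈
  ...   | b , Sb∈ | c , Tc∈ = b xor c , subst (_∈ A △ᶠ R) (△-[]≔ S T i b c) (△ᶠ⁺ A R Sb∈ Tc∈)

  -- i ∈ S △ T means i lies in S or in T; that one supplies both variants
  all : ∀ {x} → x ∈ A′ △ᶠ R′ → lookup x i ≡ true → ∀ b → x [ i ]≔ b ∈ A △ᶠ R
  all x∈ i∈x b with △ᶠ⁻ A′ R′ x∈
  ... | S , T , S∈ , T∈ , refl
      with xor≡true (lookup S i) (lookup T i) (trans (sym (lookup-zipWith _xor_ i S T)) i∈x)
  ...   | inj₁ i∈S = let c , Tc∈ = some-variant dR T∈ in
          subst (_∈ A △ᶠ R)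
            (trans (△-[]≔ S T i (b xor c) c) (cong ((S △ T) [ i ]≔_) (xor-cancelʳ b c)))
            (△ᶠ⁺ A R (all-variants dA S∈ i∈S (b xor c)) Tc∈)
  ...   | inj₂ i∈T = let c , Sc∈ = some-variant dA S∈ in
          subst (_∈ A △ᶠ R)
            (trans (△-[]≔ S T i c (c xor b)) (cong ((S △ T) [ i ]≔_) (xor-cancelˡ c b)))
            (△ᶠ⁺ A R Sc∈ (all-variants dR T∈ i∈T (c xor b)))

empty-dominated : (i : Fin n) → Dominated i (⊥ ∷ []) (⊥ ∷ [])
empty-dominated i = record
  { some-variant = λ { (here refl) → false , here ⊥-[]≔-false }
  ; all-variants = λ { (here refl) i∈⊥ → contradiction (trans (sym (lookup-replicate i false)) i∈⊥) λ () }
  }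
  where
  ⊥-[]≔-false : ⊥ [ i ]≔ false ≡ ⊥
  ⊥-[]≔-false = trans (cong (⊥ [ i ]≔_) (sym (lookup-replicate i false))) ([]≔-lookup ⊥ i)

compress-△ᶠ-all-dominated : ∀ {k} (i : Fin n) (A : Vec (Family n) k) →
                            Dominated i (△ᶠ-all (V.map (compress i) A)) (△ᶠ-all A)
compress-△ᶠ-all-dominated i []               = empty-dominated i
compress-△ᶠ-all-dominated i (B ∷ [])         = compress-dominated i B
compress-△ᶠ-all-dominated i (B ∷ Bs@(_ ∷ _)) =
  △ᶠ-dominated i (compress-dominated i B) (compress-△ᶠ-all-dominated i Bs)

Shattered : Subset n → Family n → Set
Shattered Y F = ∀ T → T ⊆ Y → ∃[ S ] S ∈ F × S ∩ Y ≡ T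

witness-contains : (x T Y : Subset n) (i : Fin n) → lookup Y i ≡ true →
                   x ∩ Y ≡ T [ i ]≔ inside → lookup x i ≡ true
witness-contains x T Y i i∈Y x∩Y≡T⁺ = begin
  lookup x i                 ≡⟨ sym (∧-identityʳ _) ⟩
  lookup x i ∧ true          ≡⟨ cong (lookup x i ∧_) (sym i∈Y) ⟩
  lookup x i ∧ lookup Y i    ≡⟨ sym (lookup-zipWith _∧_ i x Y) ⟩
  lookup (x ∩ Y) i           ≡⟨ cong (λ z → lookup z i) x∩Y≡T⁺ ⟩
  lookup (T [ i ]≔ inside) i ≡⟨ lookup∘update i T inside ⟩
  true                       ∎
  where open ≡-Reasoning

witness-variant-trace : (x T Y : Subset n) (i : Fin n) → lookup Y i ≡ true →
                        x ∩ Y ≡ T [ i ]≔ inside → (x [ i ]≔ lookup T i) ∩ Y ≡ T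
witness-variant-trace x T Y i i∈Y x∩Y≡T⁺ = begin
  (x [ i ]≔ lookup T i) ∩ Y                 ≡⟨ ∩-[]≔ x Y i (lookup T i) ⟩
  (x ∩ Y) [ i ]≔ (lookup T i ∧ lookup Y i)  ≡⟨ cong₂ _[ i ]≔_ x∩Y≡T⁺ (cong (lookup T i ∧_) i∈Y) ⟩
  (T [ i ]≔ inside) [ i ]≔ (lookup T i ∧ true) ≡⟨ cong ((T [ i ]≔ inside) [ i ]≔_) (∧-identityʳ _) ⟩
  (T [ i ]≔ inside) [ i ]≔ lookup T i       ≡⟨ []≔-idempotent T i ⟩
  T [ i ]≔ lookup T i                       ≡⟨ []≔-lookup T i ⟩
  T                                         ∎
  where open ≡-Reasoning

dominated-shattered : (i : Fin n) {B′ B : Family n} → Dominated i B′ B →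
                      (Y : Subset n) → Shattered Y B′ → Shattered Y B
dominated-shattered i d Y shB′ T T⊆Y with lookup Y i in i?Y
... | false = let x , x∈ , x∩Y≡T = shB′ T T⊆Y
                  b , xb∈ = some-variant d x∈
              in x [ i ]≔ b , xb∈ , trans (∩-[]≔-outside x Y i b i?Y) x∩Y≡T
... | true  = let x , x∈ , x∩Y≡T⁺ = shB′ (T [ i ]≔ inside) ([]≔-inside-⊆ i T Y T⊆Y i?Y)
              in x [ i ]≔ lookup T i ,
                 all-variants d x∈ (witness-contains x T Y i i?Y x∩Y≡T⁺) (lookup T i) ,
                 witness-variant-trace x T Y i i?Y x∩Y≡T⁺

∈-allSubsets : (x : Subset n) → x ∈ allSubsets n
∈-allSubsets []            = here refl
∈-allSubsets (outside ∷ x) = ∈-++⁺ˡ (∈-map⁺ (outside ∷_) (∈-allSubsets x))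
∈-allSubsets (inside ∷ x)  =
  ∈-++⁺ʳ (map (outside ∷_) (allSubsets _)) (∈-map⁺ (inside ∷_) (∈-allSubsets x))

ShatteredEnum : Subset n → Family n → Set
ShatteredEnum {n} Y F = All (λ T → T ⊆ Y → Any (λ S → S ∩ Y ≡ T) F) (allSubsets n)

shattered-sound : (Y : Subset n) (F : Family n) → ShatteredEnum Y F → Shattered Y F
shattered-sound Y F sh T T⊆Y = find (All.lookup sh (∈-allSubsets T) T⊆Y)

shattered-complete : (Y : Subset n) (F : Family n) → Shattered Y F → ShatteredEnum Y F
shattered-complete Y F sh = All.tabulate λ {T} _ T⊆Y →
  let S , S∈F , S∩Y≡T = sh T T⊆Y in lose S∈F S∩Y≡T

VC-mono : (F′ F : Family n) → (∀ Y → Shattered Y F′ → Shattered Y F) → VC F′ ≤ VC F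
VC-mono {n} F′ F shattered⇒ = go (allSubsets n)
  where
  term : Family n → Subset n → ℕ
  term G Y = if ⌊ shattered? Y G ⌋ then ∣ Y ∣ else 0

  term-mono : ∀ Y → term F′ Y ≤ term F Y
  term-mono Y with shattered? Y F′ | shattered? Y F
  ... | no  _   | _       = z≤n
  ... | yes _   | yes _   = ≤-refl
  ... | yes shY | no ¬shY =
        contradiction (shattered-complete Y F (shattered⇒ Y (shattered-sound Y F′ shY))) ¬shY

  go : (Ys : List (Subset n)) →
       L.foldr (λ Y m → term F′ Y ⊔ m) 0 Ys ≤ L.foldr (λ Y m → term F Y ⊔ m) 0 Ys
  go []       = z≤n
  go (Y ∷ Ys) = ⊔-mono-≤ (term-mono Y) (go Ys)

lemma4 : (n k : ℕ) (A : Vec (Family n) k) (i : Fin n) →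
    VC (△ᶠ-all (V.map (compress i) A)) ≤ VC (△ᶠ-all A)
lemma4 n k A i =
  VC-mono _ _ (dominated-shattered i (compress-△ᶠ-all-dominated i A))
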